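{- Let $k\ge 1$ and $t\ge (k+1)^k+1$. Then no $k$-pushdown-limited pushdown automaton accepts $D_t$.
   Context: $D_t$ is the one-sided Dyck language over $2t$ symbols, i.e. the set of well-bracketed words over an alphabet of $t$ distinct types of (left and right) parentheses. A pushdown automaton (PDA) is a nondeterministic automaton reading its input from left to right with access to a pushdown store over a fixed pushdown alphabet. A PDA is $k$-pushdown-limited if its pushdown alphabet has size $k$ and it pushes no more than $k$ symbols onto its stack between any two successive input head motions. -}

module Defs where

open import Data.Nat using (ℕ; zero; suc; _+_; _≤_)
open import Data.Fin using (Fin)
open import Data.Bool using (Bool; true)
open import Data.Maybe using (Maybe; just; nothing)
open import Data.List using (List; []; _∷_; _++_; length)
open import Data.List.Membership.Propositional using (_∈_)
open import Data.Product using (_×_; _,_; ∃)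
open import Relation.Binary.PropositionalEquality using (_≡_)
open import Relation.Binary.Construct.Closure.ReflexiveTransitive using (Star)

data Bracket (t : ℕ) : Set where
  op : Fin t → Bracket t
  cl : Fin t → Bracket t

data Dyck {t : ℕ} : List (Bracket t) → Set where
  empty : Dyck []
  nest  : ∀ (i : Fin t) {u v} → Dyck u → Dyck v →
          Dyck (op i ∷ (u ++ (cl i ∷ v)))

-- A transition  (r , γ) ∈ δ q a x  means: in state q, reading a
-- (nothing = ε-move, head does not move), popping x (nothing = pop
-- nothing; just g = the top symbol must be g and is popped), go to
-- state r and push the word γ (head of γ becomes the new top).

record PDA (Σ : Set) (k : ℕ) : Set where
  field
    nQ    : ℕ
    start : Fin nQ
    final : Fin nQ → Bool
    δ     : Fin nQ → Maybe Σ → Maybe (Fin k) → List (Fin nQ × List (Fin k))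

module _ {Σ : Set} {k : ℕ} (P : PDA Σ k) where
  open PDA P

  -- configuration: state, remaining input, stack (top first)
  Config : Set
  Config = Fin nQ × List Σ × List (Fin k)

  popped : Maybe (Fin k) → List (Fin k)
  popped nothing  = []
  popped (just g) = g ∷ []

  data EpsStep : Config → Config → ℕ → Set where
    eps : ∀ {q r w x γ s} → (r , γ) ∈ δ q nothing x →
          EpsStep (q , w , popped x ++ s) (r , w , γ ++ s) (length γ)

  data ReadStep : Config → Config → ℕ → Set where
    rd : ∀ {q r a w x γ s} → (r , γ) ∈ δ q (just a) x →
         ReadStep (q , a ∷ w , popped x ++ s) (r , w , γ ++ s) (length γ)

  data Step : Config → Config → Set where
    stepε : ∀ {c c' n} → EpsStep c c' n → Step c c'
    stepr : ∀ {c c' n} → ReadStep c c' n → Step c c'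

  data EpsRun : Config → Config → ℕ → Set where
    done : ∀ {c} → EpsRun c c 0
    more : ∀ {c c₁ c₂ m n} → EpsStep c c₁ m → EpsRun c₁ c₂ n →
           EpsRun c c₂ (m + n)

  initial : List Σ → Config
  initial w = (start , w , [])

  Reachable : List Σ → Config → Set
  Reachable w c = Star Step (initial w) c

  Accepts : List Σ → Set
  Accepts w = ∃ λ (q : Fin nQ) → ∃ λ (s : List (Fin k)) →
    final q ≡ true × Reachable w (q , [] , s)

  -- In any computation from an initial configuration, the total number of
  -- symbols pushed between two successive input head motions (the ε-moves
  -- following one head motion, together with the pushes of the next
  -- reading move) is at most k; likewise before the first / after the last
  -- head motion.
  PushLimited : Set
  PushLimited =
    (∀ {w c c' m} → Reachable w c → EpsRun c c' m → m ≤ k) ×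
    (∀ {w c c' c'' m m'} → Reachable w c → EpsRun c c' m →
       ReadStep c' c'' m' → m + m' ≤ k)

-- k-pushdown-limited: pushdown alphabet of size k (built into PDA Σ k)
-- and the push bound above.
KPushdownLimited : {Σ : Set} (k : ℕ) → PDA Σ k → Set
KPushdownLimited k P = PushLimited P

-- After reading a word of N opening brackets, the stack of a k-pushdown-limited
-- PDA has height at most kN, so the PDA can be in at most nQ (k+1)^(kN)
-- configurations, while there are t^N such words.  For N = nQ (k+1)^k Bernoulli's
-- inequality makes t^N the larger number, so two distinct words u ≠ u' lead to a
-- common configuration; the PDA then accepts u followed by the closing brackets
-- of u', which is not well bracketed.
module Submission where

open import Defs
open import Data.Nat using (ℕ; zero; suc; _+_; _*_; _^_; _≤_; _<_; z≤n; s≤s; NonZero)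
open import Data.Nat.Properties
  using ( ≤-reflexive; ≤-trans; n≤1+n; m≤m+n; m≤n+m; +-comm; +-assoc; *-comm; ^-*-assoc
        ; +-mono-≤; +-monoˡ-≤; +-monoʳ-≤; +-monoˡ-<; *-monoʳ-≤; *-cancelˡ-≤; ^-monoˡ-≤
        ; m^n>0; m^n≢0; module ≤-Reasoning )
open import Data.Nat.Solver using (module +-*-Solver)
open import Data.Fin using (Fin; zero; suc; _≟_; combine; quotient; remainder)
open import Data.Fin.Properties using (combine-injective; combine-remQuot; <⇒notInjective)
open import Data.Bool using (true)
open import Data.Maybe using (Maybe; just; nothing)
open import Data.List using (List; []; _∷_; _++_; [_]; length; map; reverse; reverseAcc)
open import Data.List.Properties
  using (length-++; length-map; map-++; ++-assoc; ++-identityʳ; unfold-reverse; reverse-injective)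
open import Data.Product using (_,_; proj₁; proj₂)
open import Function.Base using (_∘′_)
open import Function.Bundles using (_⇔_; Equivalence)
open import Relation.Nullary using (¬_; yes; no; contradiction)
open import Relation.Binary.PropositionalEquality hiding ([_])
open import Relation.Binary.Construct.Closure.ReflexiveTransitive using (Star; ε; _◅_; _◅◅_)

a^n*[a+n]≤a*[1+a]^n : ∀ a n → a ^ n * (a + n) ≤ a * suc a ^ n
a^n*[a+n]≤a*[1+a]^n a zero = ≤-reflexive (solve 1 (λ a → con 1 :* (a :+ con 0) := a :* con 1) refl a)
  where open +-*-Solver
a^n*[a+n]≤a*[1+a]^n a (suc n) = begin
  a * a ^ n * (a + suc n)            ≡⟨ solve 3 (λ a x n → a :* x :* (a :+ (con 1 :+ n))
                                              := a :* (x :* (a :+ n)) :+ a :* x) refl a (a ^ n) n ⟩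
  a * (a ^ n * (a + n)) + a * a ^ n  ≤⟨ +-mono-≤ (*-monoʳ-≤ a (a^n*[a+n]≤a*[1+a]^n a n))
                                                 (*-monoʳ-≤ a (^-monoˡ-≤ n (n≤1+n a))) ⟩
  a * (a * y) + a * y                ≡⟨ solve 2 (λ a y → a :* (a :* y) :+ a :* y
                                              := a :* ((con 1 :+ a) :* y)) refl a y ⟩
  a * (suc a * y)                    ∎
  where
  open ≤-Reasoning
  open +-*-Solver
  y = suc a ^ n

m*a^[m*a]<[1+a]^[m*a] : ∀ m a .{{_ : NonZero a}} → m * a ^ (m * a) < suc a ^ (m * a)
m*a^[m*a]<[1+a]^[m*a] m a = begin-strict
  m * x           <⟨ +-monoˡ-< (m * x) (m^n>0 a (m * a)) ⟩
  x + m * x       ≡⟨ solve 2 (λ x m → x :+ m :* x := x :* (con 1 :+ m)) refl x m ⟩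
  x * suc m       ≤⟨ *-cancelˡ-≤ a (≤-trans (≤-reflexive a*x*[1+m]≡x*[a+m*a]) (a^n*[a+n]≤a*[1+a]^n a (m * a))) ⟩
  suc a ^ (m * a) ∎
  where
  open ≤-Reasoning
  open +-*-Solver
  x = a ^ (m * a)
  a*x*[1+m]≡x*[a+m*a] : a * (x * suc m) ≡ x * (a + m * a)
  a*x*[1+m]≡x*[a+m*a] = solve 3 (λ a x m → a :* (x :* (con 1 :+ m)) := x :* (a :+ m :* a)) refl a x m

configurations<words : ∀ m k t → suc k ^ k < t →
                       m * suc k ^ (m * suc k ^ k * k) < t ^ (m * suc k ^ k)
configurations<words m k t a<t = begin-strict
  m * suc k ^ (N * k)  ≡⟨ cong (λ e → m * suc k ^ e) (*-comm N k) ⟩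
  m * suc k ^ (k * N)  ≡⟨ cong (m *_) (^-*-assoc (suc k) k N) ⟨
  m * a ^ N            <⟨ m*a^[m*a]<[1+a]^[m*a] m a {{m^n≢0 (suc k) k}} ⟩
  suc a ^ N            ≤⟨ ^-monoˡ-≤ N a<t ⟩
  t ^ N                ∎
  where
  open ≤-Reasoning
  a = suc k ^ k
  N = m * a

module _ {t : ℕ} where

  wordAt : ∀ n → Fin (t ^ n) → List (Fin t)
  wordAt zero    _ = []
  wordAt (suc n) i = quotient {t} (t ^ n) i ∷ wordAt n (remainder {t} (t ^ n) i)

  length-wordAt : ∀ n i → length (wordAt n i) ≡ n
  length-wordAt zero    i = refl
  length-wordAt (suc n) i = cong suc (length-wordAt n _)

  wordAt-injective : ∀ n {i j} → wordAt n i ≡ wordAt n j → i ≡ j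
  wordAt-injective zero    {zero} {zero} _ = refl
  wordAt-injective (suc n) {i} {j} eq = begin
    i                                                          ≡⟨ combine-remQuot {t} (t ^ n) i ⟨
    combine (quotient {t} (t ^ n) i) (remainder {t} (t ^ n) i) ≡⟨ cong₂ combine (head≡ eq) (wordAt-injective n (tail≡ eq)) ⟩
    combine (quotient {t} (t ^ n) j) (remainder {t} (t ^ n) j) ≡⟨ combine-remQuot {t} (t ^ n) j ⟩
    j                                                          ∎
    where
    open ≡-Reasoning
    head≡ : ∀ {x y : Fin t} {xs ys} → x ∷ xs ≡ y ∷ ys → x ≡ y
    head≡ refl = refl
    tail≡ : ∀ {x y : Fin t} {xs ys} → x ∷ xs ≡ y ∷ ys → xs ≡ ys
    tail≡ refl = refl

module _ {k : ℕ} where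

  -- a stack of height at most L, padded with the extra letter zero
  encodeStack : ∀ L (s : List (Fin k)) → length s ≤ L → Fin (suc k ^ L)
  encodeStack zero    []      _       = zero
  encodeStack (suc L) []      _       = combine {suc k} zero (encodeStack L [] z≤n)
  encodeStack (suc L) (g ∷ s) (s≤s h) = combine {suc k} (suc g) (encodeStack L s h)

  encodeStack-injective : ∀ L {s s'} (h : length s ≤ L) (h' : length s' ≤ L) →
                          encodeStack L s h ≡ encodeStack L s' h' → s ≡ s'
  encodeStack-injective zero    {[]}    {[]}      _       _        _  = refl
  encodeStack-injective (suc L) {[]}    {[]}      _       _        _  = refl
  encodeStack-injective (suc L) {[]}    {g' ∷ s'} _       (s≤s h') eq
    with () ← proj₁ (combine-injective zero (encodeStack L [] z≤n) (suc g') (encodeStack L s' h') eq)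
  encodeStack-injective (suc L) {g ∷ s} {[]}      (s≤s h) _        eq
    with () ← proj₁ (combine-injective (suc g) (encodeStack L s h) zero (encodeStack L [] z≤n) eq)
  encodeStack-injective (suc L) {g ∷ s} {g' ∷ s'} (s≤s h) (s≤s h') eq
    with refl , eq′ ← combine-injective (suc g) (encodeStack L s h) (suc g') (encodeStack L s' h') eq
    = cong (g ∷_) (encodeStack-injective L h h' eq′)

module _ {t : ℕ} where

  opens : List (Fin t) → List (Bracket t)
  opens = map op

  closes : List (Fin t) → List (Bracket t)
  closes u = map cl (reverse u)

  Dyck-opens-closes : ∀ u → Dyck (opens u ++ closes u)
  Dyck-opens-closes []      = empty
  Dyck-opens-closes (a ∷ u) = subst (Dyck ∘′ (op a ∷_)) (sym shape) (nest a (Dyck-opens-closes u) empty)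
    where
    open ≡-Reasoning
    shape : opens u ++ closes (a ∷ u) ≡ (opens u ++ closes u) ++ cl a ∷ []
    shape = begin
      opens u ++ map cl (reverse (a ∷ u))   ≡⟨ cong (λ v → opens u ++ map cl v) (unfold-reverse a u) ⟩
      opens u ++ map cl (reverse u ++ [ a ]) ≡⟨ cong (opens u ++_) (map-++ cl (reverse u) [ a ]) ⟩
      opens u ++ (closes u ++ [ cl a ])      ≡⟨ ++-assoc (opens u) (closes u) [ cl a ] ⟨
      (opens u ++ closes u) ++ [ cl a ]      ∎

  -- the usual stack recogniser of D_t; nothing signals a mismatch
  reduce : List (Bracket t) → List (Fin t) → Maybe (List (Fin t))
  reduce []         st       = just st
  reduce (op i ∷ w) st       = reduce w (i ∷ st)
  reduce (cl i ∷ w) []       = nothing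
  reduce (cl i ∷ w) (j ∷ st) with i ≟ j
  ... | yes _ = reduce w st
  ... | no  _ = nothing

  reduce-cl-match : ∀ i w st → reduce (cl i ∷ w) (i ∷ st) ≡ reduce w st
  reduce-cl-match i w st with i ≟ i
  ... | yes _  = refl
  ... | no i≢i = contradiction refl i≢i

  reduce-Dyck-++ : ∀ {w} → Dyck w → ∀ r st → reduce (w ++ r) st ≡ reduce r st
  reduce-Dyck-++ empty r st = refl
  reduce-Dyck-++ (nest i {u} {v} du dv) r st = begin
    reduce ((u ++ cl i ∷ v) ++ r) (i ∷ st)  ≡⟨ cong (λ w → reduce w (i ∷ st)) (++-assoc u (cl i ∷ v) r) ⟩
    reduce (u ++ cl i ∷ v ++ r) (i ∷ st)    ≡⟨ reduce-Dyck-++ du (cl i ∷ v ++ r) (i ∷ st) ⟩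
    reduce (cl i ∷ v ++ r) (i ∷ st)         ≡⟨ reduce-cl-match i (v ++ r) st ⟩
    reduce (v ++ r) st                      ≡⟨ reduce-Dyck-++ dv r st ⟩
    reduce r st                             ∎
    where open ≡-Reasoning

  reduce-opens-++ : ∀ u r st → reduce (opens u ++ r) st ≡ reduce r (reverseAcc st u)
  reduce-opens-++ []      r st = refl
  reduce-opens-++ (a ∷ u) r st = reduce-opens-++ u r (a ∷ st)

  reduce-cls≡just[]⇒≡ : ∀ v st → reduce (map cl v) st ≡ just [] → v ≡ st
  reduce-cls≡just[]⇒≡ []      []       _ = refl
  reduce-cls≡just[]⇒≡ (a ∷ v) (b ∷ st) eq with a ≟ b
  ... | yes refl = cong (a ∷_) (reduce-cls≡just[]⇒≡ v st eq)

  Dyck-opens-closes⇒≡ : ∀ u u' → Dyck (opens u ++ closes u') → u ≡ u'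
  Dyck-opens-closes⇒≡ u u' d = sym (reverse-injective (reduce-cls≡just[]⇒≡ (reverse u') (reverse u) accepted))
    where
    open ≡-Reasoning
    accepted : reduce (closes u') (reverse u) ≡ just []
    accepted = begin
      reduce (closes u') (reverse u)           ≡⟨ reduce-opens-++ u (closes u') [] ⟨
      reduce (opens u ++ closes u') []         ≡⟨ cong (λ w → reduce w []) (++-identityʳ (opens u ++ closes u')) ⟨
      reduce ((opens u ++ closes u') ++ []) [] ≡⟨ reduce-Dyck-++ d [] [] ⟩
      just []                                  ∎

module _ {Σ : Set} {k : ℕ} (P : PDA Σ k) where
  open PDA P

  height : Config P → ℕ
  height (_ , _ , s) = length s

  height-push : ∀ x γ (s : List (Fin k)) → length (γ ++ s) ≤ length (popped P x ++ s) + length γ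
  height-push x γ s = begin
    length (γ ++ s)                           ≡⟨ length-++ γ ⟩
    length γ + length s                       ≡⟨ +-comm (length γ) (length s) ⟩
    length s + length γ                       ≤⟨ +-monoˡ-≤ (length γ) (m≤n+m (length s) (length (popped P x))) ⟩
    length (popped P x) + length s + length γ ≡⟨ cong (_+ length γ) (length-++ (popped P x)) ⟨
    length (popped P x ++ s) + length γ       ∎
    where open ≤-Reasoning

  height-EpsStep : ∀ {c c' m} → EpsStep P c c' m → height c' ≤ height c + m
  height-EpsStep (eps {x = x} {γ = γ} {s = s} _) = height-push x γ s

  height-ReadStep : ∀ {c c' m} → ReadStep P c c' m → height c' ≤ height c + m
  height-ReadStep (rd {x = x} {γ = γ} {s = s} _) = height-push x γ s

  height-EpsRun : ∀ {c c' m} → EpsRun P c c' m → height c' ≤ height c + m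
  height-EpsRun {c} done = m≤m+n (height c) 0
  height-EpsRun {c} (more {m = m} {n = n} step run) = begin
    _                  ≤⟨ height-EpsRun run ⟩
    _ + n              ≤⟨ +-monoˡ-≤ n (height-EpsStep step) ⟩
    height c + m + n   ≡⟨ +-assoc (height c) m n ⟩
    height c + (m + n) ∎
    where open ≤-Reasoning

  EpsRun⇒Star : ∀ {c c' m} → EpsRun P c c' m → Star (Step P) c c'
  EpsRun⇒Star done            = ε
  EpsRun⇒Star (more step run) = stepε step ◅ EpsRun⇒Star run

  -- ε-moves and reading moves do not inspect the unread input, hence the ∀ {v}
  record FirstRead (q₀ : Fin nQ) (s₀ : List (Fin k)) (a : Σ) (w : List Σ) (cf : Config P) : Set where
    field
      {q₁ q₂}              : Fin nQ
      {s₁ s₂}              : List (Fin k)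
      {pushedε pushedRead} : ℕ
      ε-moves              : ∀ {v} → EpsRun P (q₀ , v , s₀) (q₁ , v , s₁) pushedε
      reading              : ∀ {v} → ReadStep P (q₁ , a ∷ v , s₁) (q₂ , v , s₂) pushedRead
      rest                 : Star (Step P) (q₂ , w , s₂) cf

  firstRead : ∀ {q₀ s₀ a w qf sf} → Star (Step P) (q₀ , a ∷ w , s₀) (qf , [] , sf) →
              FirstRead q₀ s₀ a w (qf , [] , sf)
  firstRead (stepε (eps e) ◅ run) = record { ε-moves = more (eps e) ε-moves ; reading = reading ; rest = rest }
    where open FirstRead (firstRead run)
  firstRead (stepr (rd e) ◅ run) = record { ε-moves = done ; reading = rd e ; rest = run }

  record Checkpoint (q₀ : Fin nQ) (s₀ : List (Fin k)) (u v : List Σ) (cf : Config P) : Set where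
    field
      {q}          : Fin nQ
      {s}          : List (Fin k)
      reading      : ∀ v' → Star (Step P) (q₀ , u ++ v' , s₀) (q , v' , s)
      rest         : Star (Step P) (q , v , s) cf
      height-bound : length s ≤ length s₀ + length u * k

  checkpoint : PushLimited P → ∀ {W} u {v q₀ s₀ qf sf} → Reachable P W (q₀ , u ++ v , s₀) →
               Star (Step P) (q₀ , u ++ v , s₀) (qf , [] , sf) → Checkpoint q₀ s₀ u v (qf , [] , sf)
  checkpoint limited []      {s₀ = s₀} _ run =
    record { reading = λ _ → ε ; rest = run ; height-bound = m≤m+n (length s₀) 0 }
  checkpoint limited (a ∷ u) {v} {s₀ = s₀} {qf} {sf} reached run = record
    { reading      = λ v' → EpsRun⇒Star ε-moves ◅◅ stepr reading ◅ Checkpoint.reading later v'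
    ; rest         = Checkpoint.rest later
    ; height-bound = begin
        _                                ≤⟨ Checkpoint.height-bound later ⟩
        length s₂ + length u * k         ≤⟨ +-monoˡ-≤ (length u * k) height₂ ⟩
        length s₀ + k + length u * k     ≡⟨ +-assoc (length s₀) k (length u * k) ⟩
        length s₀ + (k + length u * k)   ∎
    }
    where
    open FirstRead (firstRead run)
    open ≤-Reasoning
    later : Checkpoint q₂ s₂ u v (qf , [] , sf)
    later = checkpoint limited u (reached ◅◅ EpsRun⇒Star (ε-moves {a ∷ u ++ v}) ◅◅ stepr reading ◅ ε) rest
    height₂ : length s₂ ≤ length s₀ + k
    height₂ = begin
      length s₂                                ≤⟨ height-ReadStep (reading {u ++ v}) ⟩
      length s₁ + pushedRead                   ≤⟨ +-monoˡ-≤ pushedRead (height-EpsRun (ε-moves {a ∷ u ++ v})) ⟩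
      length s₀ + pushedε + pushedRead         ≡⟨ +-assoc (length s₀) pushedε pushedRead ⟩
      length s₀ + (pushedε + pushedRead)       ≤⟨ +-monoʳ-≤ (length s₀) (proj₂ limited reached (ε-moves {a ∷ u ++ v}) reading) ⟩
      length s₀ + k                            ∎

  splice : ∀ {q₀ s₀ u v u' v' cf cf'} (c : Checkpoint q₀ s₀ u v cf) (c' : Checkpoint q₀ s₀ u' v' cf') →
           (Checkpoint.q c , Checkpoint.s c) ≡ (Checkpoint.q c' , Checkpoint.s c') →
           Star (Step P) (q₀ , u ++ v' , s₀) cf'
  splice {q₀} {s₀} {u} {v' = v'} c c' eq =
    subst (λ (q , s) → Star (Step P) (q₀ , u ++ v' , s₀) (q , v' , s)) eq (Checkpoint.reading c v') ◅◅ Checkpoint.rest c'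

module FoolingSet {k t : ℕ} (P : PDA (Bracket t) k) (limited : PushLimited P)
                  (recognises : ∀ w → Dyck w ⇔ Accepts P w) (N : ℕ) where
  open PDA P

  record AcceptingCheckpoint (i : Fin (t ^ N)) : Set where
    field
      {qf}       : Fin nQ
      {sf}       : List (Fin k)
      final-qf   : final qf ≡ true
      cut        : Checkpoint P start [] (opens (wordAt N i)) (closes (wordAt N i)) (qf , [] , sf)
    open Checkpoint cut public

  acceptingCheckpoint : ∀ i → AcceptingCheckpoint i
  acceptingCheckpoint i with (_ , _ , final-qf , run) ← Equivalence.to (recognises _) (Dyck-opens-closes (wordAt N i)) =
    record { final-qf = final-qf ; cut = checkpoint P limited (opens (wordAt N i)) ε run }

  encode : ∀ {i} → AcceptingCheckpoint i → Fin (nQ * suc k ^ (N * k))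
  encode {i} c = combine q (encodeStack (N * k) s height-N)
    where
    open AcceptingCheckpoint c
    height-N : length s ≤ N * k
    height-N = subst (λ n → length s ≤ n * k) (trans (length-map op (wordAt N i)) (length-wordAt N i)) height-bound

  encode-injective : ∀ {i j} (cᵢ : AcceptingCheckpoint i) (cⱼ : AcceptingCheckpoint j) → encode cᵢ ≡ encode cⱼ → i ≡ j
  encode-injective {i} {j} cᵢ cⱼ eq
    with refl , eq′ ← combine-injective (AcceptingCheckpoint.q cᵢ) _ (AcceptingCheckpoint.q cⱼ) _ eq
    with refl ← encodeStack-injective (N * k) _ _ eq′
    = wordAt-injective N (Dyck-opens-closes⇒≡ (wordAt N i) (wordAt N j) (Equivalence.from (recognises _) mixed))
    where
    mixed : Accepts P (opens (wordAt N i) ++ closes (wordAt N j))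
    mixed = _ , _ , AcceptingCheckpoint.final-qf cⱼ , splice P (AcceptingCheckpoint.cut cᵢ) (AcceptingCheckpoint.cut cⱼ) refl

  configuration : Fin (t ^ N) → Fin (nQ * suc k ^ (N * k))
  configuration i = encode (acceptingCheckpoint i)

  configuration-injective : ∀ {i j} → configuration i ≡ configuration j → i ≡ j
  configuration-injective {i} {j} = encode-injective (acceptingCheckpoint i) (acceptingCheckpoint j)

lemma18 : (k t : ℕ) → 1 ≤ k → (k + 1) ^ k + 1 ≤ t →
    (P : PDA (Bracket t) k) → KPushdownLimited k P →
    ¬ (∀ (w : List (Bracket t)) → Dyck w ⇔ Accepts P w)
-- the count also works for k = 0
lemma18 k t _ t-large P limited recognises =
  <⇒notInjective (configurations<words nQ k t a<t) configuration-injective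
  where
  open PDA P using (nQ)
  open FoolingSet P limited recognises (nQ * suc k ^ k)
  a<t : suc k ^ k < t
  a<t = subst (_≤ t) (+-comm (suc k ^ k) 1) (subst (λ b → b ^ k + 1 ≤ t) (+-comm k 1) t-large)
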